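{- For every typing context $\Gamma$, type $\tau$ and unrestricted $\lambda_\epsilon$-terms $t,t'$: if $\Gamma\vdash t:\tau$ and $t\to t'$, then $\Gamma\vdash t':\tau$.
   Context: Unrestricted terms: $t ::= x \mid \lambda x.t \mid (s\ t) \mid \mathsf{D}(s)\cdot t \mid \epsilon t \mid s+t \mid 0$, up to $\alpha$-equivalence. $t[s/x]$ is capture-avoiding substitution. Differential substitution $\frac{\partial t}{\partial x}(s)$ (for $x$ not free in $s$): $\frac{\partial x}{\partial x}(s)=s$; $\frac{\partial y}{\partial x}(s)=0$ ($y\ne x$); $\frac{\partial(\lambda y.t)}{\partial x}(s)=\lambda y.\frac{\partial t}{\partial x}(s)$; $\frac{\partial(t\ e)}{\partial x}(s)=\big((\mathsf{D}(t)\cdot\frac{\partial e}{\partial x}(s))\ e\big)+\big(\frac{\partial t}{\partial x}(s)\ (e[x+\epsilon s/x])\big)$; $\frac{\partial(\mathsf{D}(t)\cdot e)}{\partial x}(s)=\mathsf{D}(t)\cdot\frac{\partial e}{\partial x}(s)+\mathsf{D}(\frac{\partial t}{\partial x}(s))\cdot(e[x+\epsilon s/x])+\epsilon\big(\mathsf{D}(\mathsf{D}(t)\cdot e)\cdot\frac{\partial e}{\partial x}(s)\big)$; $\frac{\partial(\epsilon t)}{\partial x}(s)=\epsilon\frac{\partial t}{\partial x}(s)$; $\frac{\partial(t+e)}{\partial x}(s)=\frac{\partial t}{\partial x}(s)+\frac{\partial e}{\partial x}(s)$; $\frac{\partial 0}{\partial x}(s)=0$. One-step reduction $\to$ is the closure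 under term contexts (reduction inside any subterm) of $(\lambda x.t)\ s\to t[s/x]$ and $\mathsf{D}(\lambda x.t)\cdot s\to\lambda x.\frac{\partial t}{\partial x}(s)$. Types: $\sigma,\tau ::= \mathbf{t}\mid\sigma\Rightarrow\tau$ over base types; contexts are lists of distinct typed variables. Typing rules: $\Gamma\vdash x:\tau$ if $x:\tau$ occurs in $\Gamma$; from $\Gamma\vdash s:\tau\Rightarrow\sigma$ and $\Gamma\vdash t:\tau$ infer $\Gamma\vdash(s\ t):\sigma$ and $\Gamma\vdash\mathsf{D}(s)\cdot t:\tau\Rightarrow\sigma$; from $\Gamma,x:\tau\vdash t:\sigma$ infer $\Gamma\vdash\lambda x.t:\tau\Rightarrow\sigma$; $\Gamma\vdash 0:\tau$ for every $\tau$; from $\Gamma\vdash s:\tau$, $\Gamma\vdash t:\tau$ infer $\Gamma\vdash s+t:\tau$; from $\Gamma\vdash t:\tau$ infer $\Gamma\vdash\epsilon t:\tau$. -}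

module Defs where

-- Terms are represented with de Bruijn indices,
-- which is the standard representation of terms up to α-equivalence.

open import Data.Nat using (ℕ; zero; suc)
open import Data.Nat using (_≟_)
open import Data.List using (List; []; _∷_)
open import Relation.Nullary using (yes; no)

infixl 6 _⊕_

data Term : Set where
  var  : ℕ → Term
  lam  : Term → Term
  app  : Term → Term → Term
  D    : Term → Term → Term
  eps  : Term → Term
  _⊕_  : Term → Term → Term
  nil  : Term

Ren : Set
Ren = ℕ → ℕ

liftRen : Ren → Ren
liftRen ρ zero    = zero
liftRen ρ (suc n) = suc (ρ n)

rename : Ren → Term → Term
rename ρ (var n)   = var (ρ n)
rename ρ (lam t)   = lam (rename (liftRen ρ) t)
rename ρ (app s t) = app (rename ρ s) (rename ρ t)
rename ρ (D s t)   = D (rename ρ s) (rename ρ t)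
rename ρ (eps t)   = eps (rename ρ t)
rename ρ (s ⊕ t)   = rename ρ s ⊕ rename ρ t
rename ρ nil       = nil

weaken : Term → Term
weaken = rename suc

Sub : Set
Sub = ℕ → Term

liftSub : Sub → Sub
liftSub σ zero    = var zero
liftSub σ (suc n) = weaken (σ n)

subst : Sub → Term → Term
subst σ (var n)   = σ n
subst σ (lam t)   = lam (subst (liftSub σ) t)
subst σ (app s t) = app (subst σ s) (subst σ t)
subst σ (D s t)   = D (subst σ s) (subst σ t)
subst σ (eps t)   = eps (subst σ t)
subst σ (s ⊕ t)   = subst σ s ⊕ subst σ t
subst σ nil       = nil

single : Term → Sub
single s zero    = s
single s (suc n) = var n

_[_/0] : Term → Term → Term
t [ s /0] = subst (single s) t

shiftSub : ℕ → Term → Sub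
shiftSub k s n with n ≟ k
... | yes _ = var k ⊕ eps s
... | no  _ = var n

-- Differential substitution  ∂t/∂x(s)  with x = index k.
-- The caller guarantees x is not free in s (in the reduction rule s is
-- weakened past the bound x, so index 0 does not occur in it).

∂ : Term → ℕ → Term → Term
∂ (var n) k s with n ≟ k
... | yes _ = s
... | no  _ = nil
∂ (lam t) k s   = lam (∂ t (suc k) (weaken s))
∂ (app t e) k s =
  app (D t (∂ e k s)) e ⊕ app (∂ t k s) (subst (shiftSub k s) e)
∂ (D t e) k s =
  D t (∂ e k s) ⊕ D (∂ t k s) (subst (shiftSub k s) e)
    ⊕ eps (D (D t e) (∂ e k s))
∂ (eps t) k s   = eps (∂ t k s)
∂ (t ⊕ e) k s   = ∂ t k s ⊕ ∂ e k s
∂ nil k s       = nil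

infix 4 _⟶_

data _⟶_ : Term → Term → Set where
  β    : ∀ {t s} → app (lam t) s ⟶ t [ s /0]
  βD   : ∀ {t s} → D (lam t) s ⟶ lam (∂ t zero (weaken s))
  ξlam : ∀ {t t'} → t ⟶ t' → lam t ⟶ lam t'
  ξappₗ : ∀ {s s' t} → s ⟶ s' → app s t ⟶ app s' t
  ξappᵣ : ∀ {s t t'} → t ⟶ t' → app s t ⟶ app s t'
  ξDₗ  : ∀ {s s' t} → s ⟶ s' → D s t ⟶ D s' t
  ξDᵣ  : ∀ {s t t'} → t ⟶ t' → D s t ⟶ D s t'
  ξeps : ∀ {t t'} → t ⟶ t' → eps t ⟶ eps t'
  ξ⊕ₗ  : ∀ {s s' t} → s ⟶ s' → s ⊕ t ⟶ s' ⊕ t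
  ξ⊕ᵣ  : ∀ {s t t'} → t ⟶ t' → s ⊕ t ⟶ s ⊕ t'

infixr 7 _⇒_

data Type : Set where
  base : ℕ → Type
  _⇒_  : Type → Type → Type

-- Typing contexts: de Bruijn index n refers to the n-th entry (0 = most
-- recently bound variable).
Ctx : Set
Ctx = List Type

infix 4 _∋_∶_ _⊢_∶_

data _∋_∶_ : Ctx → ℕ → Type → Set where
  here  : ∀ {Γ τ} → (τ ∷ Γ) ∋ zero ∶ τ
  there : ∀ {Γ n τ σ} → Γ ∋ n ∶ τ → (σ ∷ Γ) ∋ suc n ∶ τ

data _⊢_∶_ : Ctx → Term → Type → Set where
  ⊢var : ∀ {Γ n τ} → Γ ∋ n ∶ τ → Γ ⊢ var n ∶ τ
  ⊢app : ∀ {Γ s t τ σ} → Γ ⊢ s ∶ τ ⇒ σ → Γ ⊢ t ∶ τ → Γ ⊢ app s t ∶ σ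
  ⊢D   : ∀ {Γ s t τ σ} → Γ ⊢ s ∶ τ ⇒ σ → Γ ⊢ t ∶ τ → Γ ⊢ D s t ∶ τ ⇒ σ
  ⊢lam : ∀ {Γ t τ σ} → (τ ∷ Γ) ⊢ t ∶ σ → Γ ⊢ lam t ∶ τ ⇒ σ
  ⊢nil : ∀ {Γ τ} → Γ ⊢ nil ∶ τ
  ⊢⊕   : ∀ {Γ s t τ} → Γ ⊢ s ∶ τ → Γ ⊢ t ∶ τ → Γ ⊢ s ⊕ t ∶ τ
  ⊢eps : ∀ {Γ t τ} → Γ ⊢ t ∶ τ → Γ ⊢ eps t ∶ τ

module Submission where

-- Subject reduction is the usual argument for the λ-calculus, with one new
-- ingredient: the differential substitution ∂t/∂x(s) has the type of t
-- whenever s has the type of x.  Every clause of ∂ builds a sum of terms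
-- of the same type as the subterm it replaces (D(t)·u has the type of t,
-- and x + ε s has the type of x), so this is a direct induction on typing.

open import Defs
open import Data.Nat using (zero; _≟_)
open import Data.List using (_∷_)
open import Relation.Nullary using (yes; no)
open import Relation.Binary.PropositionalEquality using (_≡_; refl) renaming (subst to ≡-subst)

∋-functional : ∀ {Γ n σ τ} → Γ ∋ n ∶ σ → Γ ∋ n ∶ τ → σ ≡ τ
∋-functional here      here      = refl
∋-functional (there p) (there q) = ∋-functional p q

⊢-retype : ∀ {Γ t σ τ} → σ ≡ τ → Γ ⊢ t ∶ σ → Γ ⊢ t ∶ τ
⊢-retype = ≡-subst (_ ⊢ _ ∶_)

_⊢ʳ_∶_ : Ctx → Ren → Ctx → Set
Δ ⊢ʳ ρ ∶ Γ = ∀ {n τ} → Γ ∋ n ∶ τ → Δ ∋ ρ n ∶ τ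

_⊢ˢ_∶_ : Ctx → Sub → Ctx → Set
Δ ⊢ˢ σ ∶ Γ = ∀ {n τ} → Γ ∋ n ∶ τ → Δ ⊢ σ n ∶ τ

liftRen-typed : ∀ {Γ Δ ρ υ} → Δ ⊢ʳ ρ ∶ Γ → (υ ∷ Δ) ⊢ʳ liftRen ρ ∶ (υ ∷ Γ)
liftRen-typed ⊢ρ here      = here
liftRen-typed ⊢ρ (there p) = there (⊢ρ p)

rename-preserves-⊢ : ∀ {Γ Δ ρ t τ} → Δ ⊢ʳ ρ ∶ Γ → Γ ⊢ t ∶ τ → Δ ⊢ rename ρ t ∶ τ
rename-preserves-⊢ ⊢ρ (⊢var p)   = ⊢var (⊢ρ p)
rename-preserves-⊢ ⊢ρ (⊢app d e) = ⊢app (rename-preserves-⊢ ⊢ρ d) (rename-preserves-⊢ ⊢ρ e)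
rename-preserves-⊢ ⊢ρ (⊢D d e)   = ⊢D (rename-preserves-⊢ ⊢ρ d) (rename-preserves-⊢ ⊢ρ e)
rename-preserves-⊢ ⊢ρ (⊢lam d)   = ⊢lam (rename-preserves-⊢ (liftRen-typed ⊢ρ) d)
rename-preserves-⊢ ⊢ρ ⊢nil       = ⊢nil
rename-preserves-⊢ ⊢ρ (⊢⊕ d e)   = ⊢⊕ (rename-preserves-⊢ ⊢ρ d) (rename-preserves-⊢ ⊢ρ e)
rename-preserves-⊢ ⊢ρ (⊢eps d)   = ⊢eps (rename-preserves-⊢ ⊢ρ d)

weaken-preserves-⊢ : ∀ {Γ t τ υ} → Γ ⊢ t ∶ τ → (υ ∷ Γ) ⊢ weaken t ∶ τ
weaken-preserves-⊢ = rename-preserves-⊢ there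

liftSub-typed : ∀ {Γ Δ σ υ} → Δ ⊢ˢ σ ∶ Γ → (υ ∷ Δ) ⊢ˢ liftSub σ ∶ (υ ∷ Γ)
liftSub-typed ⊢σ here      = ⊢var here
liftSub-typed ⊢σ (there p) = weaken-preserves-⊢ (⊢σ p)

subst-preserves-⊢ : ∀ {Γ Δ σ t τ} → Δ ⊢ˢ σ ∶ Γ → Γ ⊢ t ∶ τ → Δ ⊢ subst σ t ∶ τ
subst-preserves-⊢ ⊢σ (⊢var p)   = ⊢σ p
subst-preserves-⊢ ⊢σ (⊢app d e) = ⊢app (subst-preserves-⊢ ⊢σ d) (subst-preserves-⊢ ⊢σ e)
subst-preserves-⊢ ⊢σ (⊢D d e)   = ⊢D (subst-preserves-⊢ ⊢σ d) (subst-preserves-⊢ ⊢σ e)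
subst-preserves-⊢ ⊢σ (⊢lam d)   = ⊢lam (subst-preserves-⊢ (liftSub-typed ⊢σ) d)
subst-preserves-⊢ ⊢σ ⊢nil       = ⊢nil
subst-preserves-⊢ ⊢σ (⊢⊕ d e)   = ⊢⊕ (subst-preserves-⊢ ⊢σ d) (subst-preserves-⊢ ⊢σ e)
subst-preserves-⊢ ⊢σ (⊢eps d)   = ⊢eps (subst-preserves-⊢ ⊢σ d)

single-typed : ∀ {Γ s υ} → Γ ⊢ s ∶ υ → Γ ⊢ˢ single s ∶ (υ ∷ Γ)
single-typed ⊢s here      = ⊢s
single-typed ⊢s (there p) = ⊢var p

shiftSub-typed : ∀ {Γ k s υ} → Γ ∋ k ∶ υ → Γ ⊢ s ∶ υ → Γ ⊢ˢ shiftSub k s ∶ Γ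
shiftSub-typed {k = k} ⊢k ⊢s {n} p with n ≟ k
... | yes refl = ⊢-retype (∋-functional ⊢k p) (⊢⊕ (⊢var ⊢k) (⊢eps ⊢s))
... | no  _    = ⊢var p

∂-preserves-⊢ : ∀ {Γ t τ k s υ} → Γ ∋ k ∶ υ → Γ ⊢ s ∶ υ → Γ ⊢ t ∶ τ → Γ ⊢ ∂ t k s ∶ τ
∂-preserves-⊢ {k = k} ⊢k ⊢s (⊢var {n = n} p) with n ≟ k
... | yes refl = ⊢-retype (∋-functional ⊢k p) ⊢s
... | no  _    = ⊢nil
∂-preserves-⊢ ⊢k ⊢s (⊢app d e) =
  ⊢⊕ (⊢app (⊢D d (∂-preserves-⊢ ⊢k ⊢s e)) e)
     (⊢app (∂-preserves-⊢ ⊢k ⊢s d) (subst-preserves-⊢ (shiftSub-typed ⊢k ⊢s) e))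
∂-preserves-⊢ ⊢k ⊢s (⊢D d e) =
  ⊢⊕ (⊢⊕ (⊢D d (∂-preserves-⊢ ⊢k ⊢s e))
         (⊢D (∂-preserves-⊢ ⊢k ⊢s d) (subst-preserves-⊢ (shiftSub-typed ⊢k ⊢s) e)))
     (⊢eps (⊢D (⊢D d e) (∂-preserves-⊢ ⊢k ⊢s e)))
∂-preserves-⊢ ⊢k ⊢s (⊢lam d) = ⊢lam (∂-preserves-⊢ (there ⊢k) (weaken-preserves-⊢ ⊢s) d)
∂-preserves-⊢ ⊢k ⊢s ⊢nil     = ⊢nil
∂-preserves-⊢ ⊢k ⊢s (⊢⊕ d e) = ⊢⊕ (∂-preserves-⊢ ⊢k ⊢s d) (∂-preserves-⊢ ⊢k ⊢s e)
∂-preserves-⊢ ⊢k ⊢s (⊢eps d) = ⊢eps (∂-preserves-⊢ ⊢k ⊢s d)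

β-preserves-⊢ : ∀ {Γ t s τ υ} → (υ ∷ Γ) ⊢ t ∶ τ → Γ ⊢ s ∶ υ → Γ ⊢ t [ s /0] ∶ τ
β-preserves-⊢ ⊢t ⊢s = subst-preserves-⊢ (single-typed ⊢s) ⊢t

βD-preserves-⊢ : ∀ {Γ t s τ υ} → (υ ∷ Γ) ⊢ t ∶ τ → Γ ⊢ s ∶ υ →
                 Γ ⊢ lam (∂ t zero (weaken s)) ∶ υ ⇒ τ
βD-preserves-⊢ ⊢t ⊢s = ⊢lam (∂-preserves-⊢ here (weaken-preserves-⊢ ⊢s) ⊢t)

⟶-preserves-⊢ : ∀ {Γ t t' τ} → Γ ⊢ t ∶ τ → t ⟶ t' → Γ ⊢ t' ∶ τ
⟶-preserves-⊢ (⊢app (⊢lam d) e) β         = β-preserves-⊢ d e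
⟶-preserves-⊢ (⊢D (⊢lam d) e)   βD        = βD-preserves-⊢ d e
⟶-preserves-⊢ (⊢lam d)          (ξlam r)  = ⊢lam (⟶-preserves-⊢ d r)
⟶-preserves-⊢ (⊢app d e)        (ξappₗ r) = ⊢app (⟶-preserves-⊢ d r) e
⟶-preserves-⊢ (⊢app d e)        (ξappᵣ r) = ⊢app d (⟶-preserves-⊢ e r)
⟶-preserves-⊢ (⊢D d e)          (ξDₗ r)   = ⊢D (⟶-preserves-⊢ d r) e
⟶-preserves-⊢ (⊢D d e)          (ξDᵣ r)   = ⊢D d (⟶-preserves-⊢ e r)
⟶-preserves-⊢ (⊢eps d)          (ξeps r)  = ⊢eps (⟶-preserves-⊢ d r)
⟶-preserves-⊢ (⊢⊕ d e)          (ξ⊕ₗ r)   = ⊢⊕ (⟶-preserves-⊢ d r) e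
⟶-preserves-⊢ (⊢⊕ d e)          (ξ⊕ᵣ r)   = ⊢⊕ d (⟶-preserves-⊢ e r)

mainTheorem13 : (Γ : Ctx) (τ : Type) (t t' : Term) →
    Γ ⊢ t ∶ τ → t ⟶ t' → Γ ⊢ t' ∶ τ
mainTheorem13 Γ τ t t' ⊢t t⟶t' = ⟶-preserves-⊢ ⊢t t⟶t'
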